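{- With the notation of the context, for every $n\ge1$ the following identity holds in $\mathcal{A}$: $$(\rho X)^{[n]}=\sum_{\substack{i_1+\cdots+i_k=n\\ i_1,\dots,i_k>0}}\frac{C^{(i_1)}(X)\,C^{(i_2)}(X)\cdots C^{(i_k)}(X)}{i_1(i_1+i_2)\cdots(i_1+\cdots+i_k)},$$ the sum running over all compositions of $n$ and the products being componentwise products in $\mathcal{A}$.
   Context: $\mathbb{K}$ is a field of characteristic zero; $T(X)$ is the free associative unital $\mathbb{K}$-algebra on countably many noncommuting variables $x_1,x_2,\dots$; $\mathcal{A}$ is the algebra of sequences $(y_1,y_2,\dots)$ of elements of $T(X)$ with componentwise operations; $\rho(y_1,y_2,\dots)=(0,y_1,y_1+y_2,y_1+y_2+y_3,\dots)$; $X=(x_1,x_2,\dots)\in\mathcal{A}$. $(\rho X)^{[1]}=\rho X$, $(\rho X)^{[n+1]}=\rho((\rho X)^{[n]}X)$. Define $a\bullet_\rho b:=\rho(a)b-b\rho(a)-ba$, $c^{(1)}(a)=a$, $c^{(n)}(a)=c^{(n-1)}(a)\bullet_\rho a$ (left-nested), and $C^{(n)}(a)=\rho(c^{(n)}(a))$. -}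

module Defs where

open import Level using (Level; _⊔_) renaming (suc to lsuc)
open import Algebra.Bundles using (CommutativeRing)
open import Data.Nat as ℕ using (ℕ; zero; suc; _∸_)
open import Data.List as L using (List; []; _∷_; _++_; map; concatMap; foldr; upTo)
open import Data.List.Properties using (≡-dec)
open import Data.Product using (_×_; _,_; ∃; proj₁)
open import Relation.Nullary using (¬_; yes; no)

record Field (c ℓ : Level) : Set (lsuc (c ⊔ ℓ)) where
  field
    commutativeRing : CommutativeRing c ℓ
  open CommutativeRing commutativeRing public
  field
    0≉1     : ¬ (0# ≈ 1#)
    inverse : ∀ x → ¬ (x ≈ 0#) → ∃ λ y → x * y ≈ 1#

module _ {c ℓ : Level} (F : Field c ℓ) where
  open Field F

  natK : ℕ → Carrier
  natK zero    = 0#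
  natK (suc n) = 1# + natK n

  CharZero : Set ℓ
  CharZero = ∀ n → ¬ (natK (suc n) ≈ 0#)

module Construction {c ℓ : Level} (F : Field c ℓ) (char0 : CharZero F) where
  open Field F renaming (Carrier to K)

  -- inverse of a positive natural number in K (value at 0 is an unused junk value)
  invℕ : ℕ → K
  invℕ zero    = 0#
  invℕ (suc m) = proj₁ (inverse (natK F (suc m)) (char0 m))

  -- The free associative unital K-algebra T(X) on noncommuting variables
  -- x_1, x_2, ... (variable x_{i+1} is encoded by the index i : ℕ).
  -- Monomials are words (List ℕ); an element is a finite formal
  -- K-linear combination of words, and two elements are equal when
  -- they have the same coefficient at every word.

  Word : Set
  Word = List ℕ

  T : Set c
  T = List (K × Word)

  coeff : T → Word → K
  coeff []             w = 0#
  coeff ((a , u) ∷ t) w with ≡-dec ℕ._≟_ u w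
  ... | yes _ = a + coeff t w
  ... | no  _ = coeff t w

  _≈T_ : T → T → Set ℓ
  s ≈T t = ∀ w → coeff s w ≈ coeff t w

  0T : T
  0T = []

  1T : T
  1T = (1# , []) ∷ []

  _+T_ : T → T → T
  s +T t = s ++ t

  -T_ : T → T
  -T t = map (λ { (a , u) → (- a , u) }) t

  _-T_ : T → T → T
  s -T t = s +T (-T t)

  _*T_ : T → T → T
  s *T t = concatMap (λ { (a , u) → map (λ { (b , v) → (a * b , u ++ v) }) t }) s

  _·T_ : K → T → T
  k ·T t = map (λ { (a , u) → (k * a , u) }) t

  var : ℕ → T
  var i = (1# , i ∷ []) ∷ []

  -- The algebra 𝒜 of sequences (y_1, y_2, ...) of elements of T(X),
  -- with componentwise operations (component y_{m+1} is at index m).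

  𝒜 : Set c
  𝒜 = ℕ → T

  _≈𝒜_ : 𝒜 → 𝒜 → Set ℓ
  a ≈𝒜 b = ∀ m → a m ≈T b m

  _+𝒜_ : 𝒜 → 𝒜 → 𝒜
  (a +𝒜 b) m = a m +T b m

  _-𝒜_ : 𝒜 → 𝒜 → 𝒜
  (a -𝒜 b) m = a m -T b m

  _*𝒜_ : 𝒜 → 𝒜 → 𝒜
  (a *𝒜 b) m = a m *T b m

  _·𝒜_ : K → 𝒜 → 𝒜
  (k ·𝒜 a) m = k ·T a m

  0𝒜 : 𝒜
  0𝒜 _ = 0T

  1𝒜 : 𝒜
  1𝒜 _ = 1T

  ρ : 𝒜 → 𝒜
  ρ y zero    = 0T
  ρ y (suc m) = ρ y m +T y m

  X : 𝒜
  X m = var m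

  -- (ρX)^[1] = ρX, (ρX)^[n+1] = ρ((ρX)^[n] X)   (index 0: unused junk value)
  ρXpow : ℕ → 𝒜
  ρXpow zero          = ρ X
  ρXpow (suc zero)    = ρ X
  ρXpow (suc (suc n)) = ρ (ρXpow (suc n) *𝒜 X)

  _•ρ_ : 𝒜 → 𝒜 → 𝒜
  a •ρ b = ((ρ a *𝒜 b) -𝒜 (b *𝒜 ρ a)) -𝒜 (b *𝒜 a)

  -- c^(1)(a) = a, c^(n)(a) = c^(n-1)(a) •ρ a   (index 0: unused junk value)
  c⁽_⁾ : ℕ → 𝒜 → 𝒜
  c⁽ zero ⁾        a = a
  c⁽ suc zero ⁾    a = a
  c⁽ suc (suc n) ⁾ a = c⁽ suc n ⁾ a •ρ a

  C⁽_⁾ : ℕ → 𝒜 → 𝒜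
  C⁽ n ⁾ a = ρ (c⁽ n ⁾ a)

  -- Compositions of n: lists (i_1, ..., i_k) of positive naturals with
  -- i_1 + ... + i_k = n.  compositionsF fuel m enumerates them for m ≤ fuel
  -- (first part i ranges over 1..m).

  compositionsF : ℕ → ℕ → List (List ℕ)
  compositionsF _          zero    = [] ∷ []
  compositionsF zero       (suc m) = []
  compositionsF (suc fuel) (suc m) =
    concatMap (λ i → map (suc i ∷_) (compositionsF fuel (m ∸ i))) (upTo (suc m))

  compositions : ℕ → List (List ℕ)
  compositions n = compositionsF n n

  denomFrom : ℕ → List ℕ → ℕ
  denomFrom s []       = 1
  denomFrom s (i ∷ is) = (s ℕ.+ i) ℕ.* denomFrom (s ℕ.+ i) is

  denom : List ℕ → ℕ
  denom = denomFrom 0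

  prodC : List ℕ → 𝒜
  prodC []       = 1𝒜
  prodC (i ∷ is) = C⁽ i ⁾ X *𝒜 prodC is

  sum𝒜 : List 𝒜 → 𝒜
  sum𝒜 = foldr _+𝒜_ 0𝒜

  rhs : ℕ → 𝒜
  rhs n = sum𝒜 (map (λ is → invℕ (denom is) ·𝒜 prodC is) (compositions n))

-- Put P 0 = 1 and P (n + 1) = ρ (P n · X), so that P n = (ρX)^[n] for n ≥ 1, and write C j = C^(j)(X).
-- Both sides of the identity solve the recursion  n · u n = Σ_{k<n} u k · C (n − k),  u 0 = 1,
-- which has only one solution because every n ≥ 1 is invertible in K.
-- For P, induction gives n · P (n + 1) = Σ_{i<n} ρ (P i · C (n − i) · X), and the weight-one
-- Rota–Baxter identity ρa · ρb = ρ (ρa · b + a · ρb + a · b) shows that the i-th term differs from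
-- P (i + 1) · C (n − i) by g i − g (i + 1), where g i = ρ (P i · c^(n+1−i)(X)); so the sum telescopes.
-- For the sum over compositions, shift every partial sum in the denominators by s; expanding along the
-- first part of a composition and inducting on n gives (s + n) · S_s(n) = Σ_{k<n} S_s(k) · C (n − k).
module Submission where

open import Level using (Level; _⊔_)
open import Algebra.Bundles using (CommutativeMonoid; Ring; RawRing)
open import Algebra.Structures using (IsRing)
open import Algebra.Morphism.Structures using (IsMonoidHomomorphism; IsRingMonomorphism)
import Algebra.Construct.Pointwise as Pointwise
import Algebra.Morphism.RingMonomorphism as RingMonomorphism
open import Data.Nat as ℕ using (ℕ; zero; suc; _∸_; _<_; _≤_; s≤s; z≤n)
import Data.Nat.Properties as ℕ
open import Data.List using (List; []; _∷_; _++_; map; concatMap; foldr; applyUpTo; upTo)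
open import Data.List.Properties
  using (≡-dec; ∷-injectiveˡ; ∷-injectiveʳ; ++-identityʳ; concatMap-cong)
open import Data.Product using (_,_; proj₂)
open import Function using (_∘_; id)
open import Relation.Nullary using (Dec; yes; no; contradiction)
open import Relation.Binary.PropositionalEquality as ≡ using (_≡_; _≢_)
open import Defs

private variable r ℓ : Level

module FiniteSums (M : CommutativeMonoid r ℓ) where
  open CommutativeMonoid M
    renaming (_∙_ to _+_; ε to 0#; ∙-cong to +-cong; ∙-congˡ to +-congˡ; ∙-congʳ to +-congʳ;
              identityˡ to +-identityˡ; identityʳ to +-identityʳ; assoc to +-assoc; comm to +-comm)
  open import Algebra.Properties.CommutativeSemigroup commutativeSemigroup using (interchange)
  open import Algebra.Properties.CommutativeMonoid.Mult M using (_×_; ×-congʳ; ×-distrib-+)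
  open import Relation.Binary.Reasoning.Setoid setoid

  ∑< : ℕ → (ℕ → Carrier) → Carrier
  ∑< zero    f = 0#
  ∑< (suc n) f = f 0 + ∑< n (f ∘ suc)

  infixl 10 ∑<
  syntax ∑< n (λ i → x) = ∑[ i < n ] x

  ∑-cong< : ∀ n {f g : ℕ → Carrier} → (∀ i → i < n → f i ≈ g i) → ∑< n f ≈ ∑< n g
  ∑-cong< zero    f≈g = refl
  ∑-cong< (suc n) f≈g = +-cong (f≈g 0 (s≤s z≤n)) (∑-cong< n λ i i<n → f≈g (suc i) (s≤s i<n))

  ∑-cong : ∀ n {f g : ℕ → Carrier} → (∀ i → f i ≈ g i) → ∑< n f ≈ ∑< n g
  ∑-cong n f≈g = ∑-cong< n λ i _ → f≈g i

  ∑-distrib-+ : ∀ n (f g : ℕ → Carrier) → ∑[ i < n ] (f i + g i) ≈ ∑< n f + ∑< n g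
  ∑-distrib-+ zero    f g = sym (+-identityˡ 0#)
  ∑-distrib-+ (suc n) f g = begin
    (f 0 + g 0) + ∑[ i < n ] (f (suc i) + g (suc i))
      ≈⟨ +-congˡ (∑-distrib-+ n (f ∘ suc) (g ∘ suc)) ⟩
    (f 0 + g 0) + (∑< n (f ∘ suc) + ∑< n (g ∘ suc))
      ≈⟨ interchange _ _ _ _ ⟩
    (f 0 + ∑< n (f ∘ suc)) + (g 0 + ∑< n (g ∘ suc)) ∎

  ∑-init-last : ∀ n (f : ℕ → Carrier) → ∑< (suc n) f ≈ ∑< n f + f n
  ∑-init-last zero    f = +-comm (f 0) 0#
  ∑-init-last (suc n) f = trans (+-congˡ (∑-init-last n (f ∘ suc))) (sym (+-assoc _ _ _))

  ∑-telescope : ∀ n {x y g : ℕ → Carrier} → (∀ i → i < n → x i + g (suc i) ≈ g i + y i) →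
                ∑< n x + g n ≈ g 0 + ∑< n y
  ∑-telescope zero                step = +-comm 0# _
  ∑-telescope (suc n) {x} {y} {g} step = begin
    (x 0 + ∑< n (x ∘ suc)) + g (suc n)
      ≈⟨ +-assoc _ _ _ ⟩
    x 0 + (∑< n (x ∘ suc) + g (suc n))
      ≈⟨ +-congˡ (∑-telescope n λ i i<n → step (suc i) (s≤s i<n)) ⟩
    x 0 + (g 1 + ∑< n (y ∘ suc))
      ≈⟨ +-assoc _ _ _ ⟨
    (x 0 + g 1) + ∑< n (y ∘ suc)
      ≈⟨ +-congʳ (step 0 (s≤s z≤n)) ⟩
    (g 0 + y 0) + ∑< n (y ∘ suc)
      ≈⟨ +-assoc _ _ _ ⟩
    g 0 + (y 0 + ∑< n (y ∘ suc)) ∎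

  ∑-triangle : ∀ n (G : ℕ → ℕ → Carrier) →
               ∑[ i < n ] ∑[ j < n ∸ i ] G i (i ℕ.+ j) ≈ ∑[ k < n ] ∑[ i < suc k ] G i k
  ∑-triangle zero    G = refl
  ∑-triangle (suc n) G = begin
    ∑< (suc n) (G 0) + ∑[ i < n ] ∑[ j < n ∸ i ] G (suc i) (suc (i ℕ.+ j))
      ≈⟨ +-congˡ (∑-triangle n λ i k → G (suc i) (suc k)) ⟩
    ∑< (suc n) (G 0) + ∑[ k < n ] ∑[ i < suc k ] G (suc i) (suc k)
      ≈⟨ +-congˡ (+-identityˡ _) ⟨
    ∑< (suc n) (G 0) + (0# + ∑[ k < n ] ∑[ i < suc k ] G (suc i) (suc k))
      ≈⟨ ∑-distrib-+ (suc n) (G 0) (λ k → ∑[ i < k ] G (suc i) k) ⟨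
    ∑[ k < suc n ] (G 0 k + ∑[ i < k ] G (suc i) k) ∎

  ∑ₗ : {A : Set} → List A → (A → Carrier) → Carrier
  ∑ₗ xs f = foldr _+_ 0# (map f xs)

  ∑ₗ-cong : ∀ {A : Set} (xs : List A) {f g : A → Carrier} →
            (∀ x → f x ≈ g x) → ∑ₗ xs f ≈ ∑ₗ xs g
  ∑ₗ-cong []       f≈g = refl
  ∑ₗ-cong (x ∷ xs) f≈g = +-cong (f≈g x) (∑ₗ-cong xs f≈g)

  ∑ₗ-++ : ∀ {A : Set} (xs ys : List A) f → ∑ₗ (xs ++ ys) f ≈ ∑ₗ xs f + ∑ₗ ys f
  ∑ₗ-++ []       ys f = sym (+-identityˡ _)
  ∑ₗ-++ (x ∷ xs) ys f = trans (+-congˡ (∑ₗ-++ xs ys f)) (sym (+-assoc _ _ _))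

  ∑ₗ-concatMap : ∀ {A B : Set} (g : A → List B) xs f →
                 ∑ₗ (concatMap g xs) f ≈ ∑ₗ xs (λ x → ∑ₗ (g x) f)
  ∑ₗ-concatMap g []       f = refl
  ∑ₗ-concatMap g (x ∷ xs) f =
    trans (∑ₗ-++ (g x) (concatMap g xs) f) (+-congˡ (∑ₗ-concatMap g xs f))

  ∑ₗ-map : ∀ {A B : Set} (g : A → B) xs f → ∑ₗ (map g xs) f ≈ ∑ₗ xs (f ∘ g)
  ∑ₗ-map g []       f = refl
  ∑ₗ-map g (x ∷ xs) f = +-congˡ (∑ₗ-map g xs f)

  ∑ₗ-applyUpTo : ∀ (g : ℕ → ℕ) n f → ∑ₗ (applyUpTo g n) f ≈ ∑[ i < n ] f (g i)
  ∑ₗ-applyUpTo g zero    f = refl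
  ∑ₗ-applyUpTo g (suc n) f = +-congˡ (∑ₗ-applyUpTo (g ∘ suc) n f)

  module _ {h : Carrier → Carrier} (h-homo : IsMonoidHomomorphism rawMonoid rawMonoid h) where
    open IsMonoidHomomorphism h-homo

    ∑-homo : ∀ n (f : ℕ → Carrier) → h (∑< n f) ≈ ∑[ i < n ] h (f i)
    ∑-homo zero    f = ε-homo
    ∑-homo (suc n) f = trans (homo _ _) (+-congˡ (∑-homo n (f ∘ suc)))

    homo-× : ∀ n x → h (n × x) ≈ n × h x
    homo-× zero    x = ε-homo
    homo-× (suc n) x = trans (homo x (n × x)) (+-congˡ (homo-× n x))

    ∑ₗ-homo : ∀ {A : Set} (xs : List A) f → h (∑ₗ xs f) ≈ ∑ₗ xs (h ∘ f)
    ∑ₗ-homo []       f = ε-homo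
    ∑ₗ-homo (x ∷ xs) f = trans (homo _ _) (+-congˡ (∑ₗ-homo xs f))

  ×-isMonoidHomomorphism : ∀ n → IsMonoidHomomorphism rawMonoid rawMonoid (n ×_)
  ×-isMonoidHomomorphism n = record
    { isMagmaHomomorphism = record
      { isRelHomomorphism = record { cong = ×-congʳ n }
      ; homo              = λ x y → ×-distrib-+ x y n
      }
    ; ε-homo = ×-zero n
    }
    where
    ×-zero : ∀ n → n × 0# ≈ 0#
    ×-zero zero    = refl
    ×-zero (suc n) = trans (+-identityˡ _) (×-zero n)

module RingSums (R : Ring r ℓ) where
  open Ring R
  open FiniteSums +-commutativeMonoid public

  ∑-distribˡ : ∀ x n (f : ℕ → Carrier) → x * ∑< n f ≈ ∑[ i < n ] (x * f i)
  ∑-distribˡ x zero    f = zeroʳ x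
  ∑-distribˡ x (suc n) f = trans (distribˡ x _ _) (+-congˡ (∑-distribˡ x n (f ∘ suc)))

  ∑-distribʳ : ∀ x n (f : ℕ → Carrier) → ∑< n f * x ≈ ∑[ i < n ] (f i * x)
  ∑-distribʳ x zero    f = zeroˡ x
  ∑-distribʳ x (suc n) f = trans (distribʳ x _ _) (+-congˡ (∑-distribʳ x n (f ∘ suc)))

  ∑ₗ-distribˡ : ∀ x {A : Set} (xs : List A) f → x * ∑ₗ xs f ≈ ∑ₗ xs (λ a → x * f a)
  ∑ₗ-distribˡ x []       f = zeroʳ x
  ∑ₗ-distribˡ x (a ∷ xs) f = trans (distribˡ x _ _) (+-congˡ (∑ₗ-distribˡ x xs f))

module _ (R : Ring r ℓ) where
  open Ring R
  open RingSums R
  open import Algebra.Properties.Semiring.Mult semiring using (_×_)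
  open import Data.Nat.Induction using (<-rec)
  open import Relation.Binary.Reasoning.Setoid setoid

  SolvesRecursion : (ℕ → Carrier) → (ℕ → Carrier) → Set ℓ
  SolvesRecursion C u = ∀ n → n × u n ≈ ∑[ k < n ] (u k * C (n ∸ k))

  solvesRecursion-unique : (∀ n {x y} → suc n × x ≈ suc n × y → x ≈ y) →
    ∀ {C u v} → SolvesRecursion C u → SolvesRecursion C v → u 0 ≈ v 0 → ∀ n → u n ≈ v n
  solvesRecursion-unique ×-cancel {C} {u} {v} u-solves v-solves u₀≈v₀ = <-rec _ agree
    where
    agree : ∀ n → (∀ {k} → k < n → u k ≈ v k) → u n ≈ v n
    agree zero    _   = u₀≈v₀
    agree (suc n) u≈v = ×-cancel n (begin
      suc n × u (suc n)
        ≈⟨ u-solves (suc n) ⟩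
      ∑[ k < suc n ] (u k * C (suc n ∸ k))
        ≈⟨ ∑-cong< (suc n) (λ k k<1+n → *-congʳ {C (suc n ∸ k)} (u≈v k<1+n)) ⟩
      ∑[ k < suc n ] (v k * C (suc n ∸ k))
        ≈⟨ v-solves (suc n) ⟨
      suc n × v (suc n) ∎)

  record IsWeightOneRotaBaxter (ρ : Carrier → Carrier) : Set (r ⊔ ℓ) where
    field
      +-isMonoidHomomorphism : IsMonoidHomomorphism +-rawMonoid +-rawMonoid ρ
      rotaBaxter             : ∀ x y → ρ x * ρ y ≈ ρ (ρ x * y + x * ρ y + x * y)

    open IsMonoidHomomorphism +-isMonoidHomomorphism public
      renaming (⟦⟧-cong to ρ-cong; homo to ρ-+)

module RotaBaxterRecursion
  (R : Ring r ℓ) {ρ} (ρ-isRotaBaxter : IsWeightOneRotaBaxter R ρ) (a : Ring.Carrier R) where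
  open Ring R
  open RingSums R
  open IsWeightOneRotaBaxter ρ-isRotaBaxter
  open import Algebra.Properties.Semiring.Mult semiring using (_×_; ×-assoc-*)
  open import Algebra.Properties.Group +-group using (//-rightDividesˡ)
  open import Algebra.Solver.CommutativeMonoid +-commutativeMonoid using (solve; _⊜_; _⊕_)
  open import Relation.Binary.Reasoning.Setoid setoid

  infixl 7 _•_
  _•_ : Carrier → Carrier → Carrier
  x • y = ρ x * y - y * ρ x - y * x

  c : ℕ → Carrier
  c zero          = a
  c (suc zero)    = a
  c (suc (suc n)) = c (suc n) • a

  C : ℕ → Carrier
  C n = ρ (c n)

  ρPow : ℕ → Carrier
  ρPow zero    = 1#
  ρPow (suc n) = ρ (ρPow n * a)

  *-•-unfold : ∀ p x y → p * (x • y) + p * y * x + p * y * ρ x ≈ p * ρ x * y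
  *-•-unfold p x y = begin
    p * (x • y) + p * y * x + p * y * ρ x
      ≈⟨ +-cong (+-congˡ (*-assoc p y x)) (*-assoc p y (ρ x)) ⟩
    p * (x • y) + p * (y * x) + p * (y * ρ x)
      ≈⟨ +-congʳ (distribˡ p _ _) ⟨
    p * (x • y + y * x) + p * (y * ρ x)
      ≈⟨ distribˡ p _ _ ⟨
    p * (x • y + y * x + y * ρ x)
      ≈⟨ *-congˡ x•y+yx+yρx≈ρxy ⟩
    p * (ρ x * y)
      ≈⟨ *-assoc p (ρ x) y ⟨
    p * ρ x * y ∎
    where
    x•y+yx+yρx≈ρxy : x • y + y * x + y * ρ x ≈ ρ x * y
    x•y+yx+yρx≈ρxy =
      trans (+-congʳ (//-rightDividesˡ (y * x) _)) (//-rightDividesˡ (y * ρ x) (ρ x * y))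

  -- Rota–Baxter expands ρPow (suc i) * C m into three ρ-terms, two of which cancel
  -- against the unfolding of c (suc m) = c m • a.
  telescoping-step : ∀ i m → 0 < m →
    ρ (ρPow i * C m * a) + ρ (ρPow (suc i) * c m) ≈ ρ (ρPow i * c (suc m)) + ρPow (suc i) * C m
  telescoping-step i (suc j) _ = begin
    ρ (p * C′ * a) + ρ (ρPow (suc i) * c′)
      ≈⟨ +-congʳ (ρ-cong (*-•-unfold p c′ a)) ⟨
    ρ (p * c″ + p * a * c′ + p * a * C′) + ρ (ρPow (suc i) * c′)
      ≈⟨ +-congʳ (trans (ρ-+ _ _) (+-congʳ (ρ-+ _ _))) ⟩
    ρ (p * c″) + ρ (p * a * c′) + ρ (p * a * C′) + ρ (ρPow (suc i) * c′)
      ≈⟨ solve 4 (λ A B D E → ((A ⊕ B) ⊕ D) ⊕ E ⊜ A ⊕ ((E ⊕ D) ⊕ B)) refl _ _ _ _ ⟩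
    ρ (p * c″) + (ρ (ρPow (suc i) * c′) + ρ (p * a * C′) + ρ (p * a * c′))
      ≈⟨ +-congˡ (trans (ρ-+ _ _) (+-congʳ (ρ-+ _ _))) ⟨
    ρ (p * c″) + ρ (ρPow (suc i) * c′ + p * a * C′ + p * a * c′)
      ≈⟨ +-congˡ (rotaBaxter (p * a) c′) ⟨
    ρ (p * c″) + ρPow (suc i) * C′ ∎
    where
    p c′ c″ C′ : Carrier
    p = ρPow i; c′ = c (suc j); c″ = c (suc (suc j)); C′ = C (suc j)

  ρPow-solvesRecursion : SolvesRecursion R C ρPow
  ρPow-solvesRecursion zero    = refl
  ρPow-solvesRecursion (suc n) = begin
    ρPow (suc n) + n × ρPow (suc n)  ≈⟨ +-comm _ _ ⟩
    n × ρPow (suc n) + ρPow (suc n)  ≈⟨ +-cong n×ρPow[1+n] (sym g-last) ⟩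
    ∑< n x + g n                     ≈⟨ ∑-telescope n step ⟩
    g 0 + ∑< n y                     ≈⟨ +-congʳ g-first ⟩
    1# * C (suc n) + ∑< n y          ∎
    where
    x g y : ℕ → Carrier
    x i = ρ (ρPow i * C (n ∸ i) * a)
    g i = ρ (ρPow i * c (suc n ∸ i))
    y i = ρPow (suc i) * C (n ∸ i)

    n×ρPow[1+n] : n × ρPow (suc n) ≈ ∑< n x
    n×ρPow[1+n] = begin
      n × ρ (ρPow n * a)                       ≈⟨ homo-× +-isMonoidHomomorphism n _ ⟨
      ρ (n × (ρPow n * a))                     ≈⟨ ρ-cong (×-assoc-* n _ _) ⟨
      ρ (n × ρPow n * a)                       ≈⟨ ρ-cong (*-congʳ (ρPow-solvesRecursion n)) ⟩
      ρ (∑[ i < n ] (ρPow i * C (n ∸ i)) * a)  ≈⟨ ρ-cong (∑-distribʳ a n _) ⟩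
      ρ (∑[ i < n ] (ρPow i * C (n ∸ i) * a))  ≈⟨ ∑-homo +-isMonoidHomomorphism n _ ⟩
      ∑< n x                                   ∎

    step : ∀ i → i < n → x i + g (suc i) ≈ g i + y i
    step i i<n = trans (telescoping-step i (n ∸ i) (ℕ.m<n⇒0<n∸m i<n))
      (+-congʳ (ρ-cong (*-congˡ (reflexive (≡.cong c (≡.sym (ℕ.+-∸-assoc 1 (ℕ.<⇒≤ i<n))))))))

    g-first : g 0 ≈ 1# * C (suc n)
    g-first = trans (ρ-cong (*-identityˡ _)) (sym (*-identityˡ _))

    g-last : g n ≈ ρPow (suc n)
    g-last = ρ-cong (*-congˡ (reflexive (≡.cong c (ℕ.m+n∸n≡m 1 n))))

module FreeAlgebra {c ℓ : Level} (F : Field c ℓ) (char0 : CharZero F) where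
  open Field F renaming (Carrier to K)
  open Construction F char0
  open import Algebra.Properties.Ring ring using (-0#≈0#; -‿+-comm)
  open import Algebra.Properties.CommutativeSemigroup +-commutativeSemigroup using (interchange)
  open import Algebra.Properties.CommutativeSemigroup *-commutativeSemigroup using (x∙yz≈y∙xz)
  open import Relation.Binary.Reasoning.Setoid setoid

  Series : Set c
  Series = Word → K

  infix  4 _≐_
  infixl 6 _⊕_
  infixl 7 _⋆_
  infixr 8 _⊙_

  _≐_ : Series → Series → Set ℓ
  f ≐ g = ∀ w → f w ≈ g w

  _⊕_ : Series → Series → Series
  (f ⊕ g) w = f w + g w

  ⊖_ : Series → Series
  (⊖ f) w = - f w

  _⊙_ : K → Series → Series
  (k ⊙ f) w = k * f w

  0ₛ : Series
  0ₛ _ = 0#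

  -- (f ⋆ g) w = Σ_{u v = w} f u * g v, computed by splitting off the first letter of u.
  _⋆_ : Series → Series → Series
  (f ⋆ g) []      = f [] * g []
  (f ⋆ g) (x ∷ w) = f [] * g (x ∷ w) + (f ∘ (x ∷_) ⋆ g) w

  monomial : K → Word → Series
  monomial a u = coeff ((a , u) ∷ [])

  1ₛ : Series
  1ₛ = monomial 1# []

  coeff-∷ : ∀ a u t → coeff ((a , u) ∷ t) ≐ monomial a u ⊕ coeff t
  coeff-∷ a u t w with ≡-dec ℕ._≟_ u w
  ... | yes _ = +-congʳ (sym (+-identityʳ a))
  ... | no  _ = sym (+-identityˡ _)

  monomial-≡ : ∀ a u w → u ≡ w → monomial a u w ≈ a
  monomial-≡ a u w u≡w with ≡-dec ℕ._≟_ u w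
  ... | yes _   = +-identityʳ a
  ... | no  u≢w = contradiction u≡w u≢w

  monomial-≢ : ∀ a u w → u ≢ w → monomial a u w ≈ 0#
  monomial-≢ a u w u≢w with ≡-dec ℕ._≟_ u w
  ... | yes u≡w = contradiction u≡w u≢w
  ... | no  _   = refl

  *-monomial : ∀ k a u → k ⊙ monomial a u ≐ monomial (k * a) u
  *-monomial k a u w with ≡-dec ℕ._≟_ u w
  ... | yes _ = trans (*-congˡ (+-identityʳ a)) (sym (+-identityʳ _))
  ... | no  _ = zeroʳ k

  -‿monomial : ∀ a u → monomial (- a) u ≐ ⊖ monomial a u
  -‿monomial a u w with ≡-dec ℕ._≟_ u w
  ... | yes _ = trans (+-identityʳ _) (-‿cong (sym (+-identityʳ a)))
  ... | no  _ = sym -0#≈0#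

  monomial-∷ : ∀ a x u → monomial a (x ∷ u) ∘ (x ∷_) ≐ monomial a u
  monomial-∷ a x u w = by-cases (≡-dec ℕ._≟_ u w)
    where
    by-cases : Dec (u ≡ w) → monomial a (x ∷ u) (x ∷ w) ≈ monomial a u w
    by-cases (yes u≡w) =
      trans (monomial-≡ a (x ∷ u) (x ∷ w) (≡.cong (x ∷_) u≡w)) (sym (monomial-≡ a u w u≡w))
    by-cases (no  u≢w) =
      trans (monomial-≢ a (x ∷ u) (x ∷ w) (u≢w ∘ ∷-injectiveʳ)) (sym (monomial-≢ a u w u≢w))

  ⋆-cong : ∀ {f f′ g g′} → f ≐ f′ → g ≐ g′ → f ⋆ g ≐ f′ ⋆ g′
  ⋆-cong f≐f′ g≐g′ []      = *-cong (f≐f′ []) (g≐g′ [])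
  ⋆-cong f≐f′ g≐g′ (x ∷ w) =
    +-cong (*-cong (f≐f′ []) (g≐g′ (x ∷ w))) (⋆-cong (f≐f′ ∘ (x ∷_)) g≐g′ w)

  ⋆-zeroˡ : ∀ {f} g → f ≐ 0ₛ → f ⋆ g ≐ 0ₛ
  ⋆-zeroˡ g f≐0 []      = trans (*-congʳ (f≐0 [])) (zeroˡ _)
  ⋆-zeroˡ g f≐0 (x ∷ w) =
    trans (+-cong (trans (*-congʳ (f≐0 [])) (zeroˡ _)) (⋆-zeroˡ g (f≐0 ∘ (x ∷_)) w))
      (+-identityʳ 0#)

  ⋆-zeroʳ : ∀ f {g} → g ≐ 0ₛ → f ⋆ g ≐ 0ₛ
  ⋆-zeroʳ f g≐0 []      = trans (*-congˡ (g≐0 [])) (zeroʳ _)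
  ⋆-zeroʳ f g≐0 (x ∷ w) =
    trans (+-cong (trans (*-congˡ (g≐0 (x ∷ w))) (zeroʳ _)) (⋆-zeroʳ (f ∘ (x ∷_)) g≐0 w))
      (+-identityʳ 0#)

  ⋆-distribˡ : ∀ f g g′ → f ⋆ (g ⊕ g′) ≐ f ⋆ g ⊕ f ⋆ g′
  ⋆-distribˡ f g g′ []      = distribˡ (f []) (g []) (g′ [])
  ⋆-distribˡ f g g′ (x ∷ w) =
    trans (+-cong (distribˡ _ _ _) (⋆-distribˡ (f ∘ (x ∷_)) g g′ w)) (interchange _ _ _ _)

  ⋆-distribʳ : ∀ g f f′ → (f ⊕ f′) ⋆ g ≐ f ⋆ g ⊕ f′ ⋆ g
  ⋆-distribʳ g f f′ []      = distribʳ (g []) (f []) (f′ [])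
  ⋆-distribʳ g f f′ (x ∷ w) =
    trans (+-cong (distribʳ _ _ _) (⋆-distribʳ g (f ∘ (x ∷_)) (f′ ∘ (x ∷_)) w))
      (interchange _ _ _ _)

  ⊙-⋆-assoc : ∀ k f g → k ⊙ f ⋆ g ≐ k ⊙ (f ⋆ g)
  ⊙-⋆-assoc k f g []      = *-assoc k (f []) (g [])
  ⊙-⋆-assoc k f g (x ∷ w) =
    trans (+-cong (*-assoc k _ _) (⊙-⋆-assoc k (f ∘ (x ∷_)) g w)) (sym (distribˡ k _ _))

  ⋆-⊙-comm : ∀ k f g → f ⋆ k ⊙ g ≐ k ⊙ (f ⋆ g)
  ⋆-⊙-comm k f g []      = x∙yz≈y∙xz (f []) k (g [])
  ⋆-⊙-comm k f g (x ∷ w) =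
    trans (+-cong (x∙yz≈y∙xz _ k _) (⋆-⊙-comm k (f ∘ (x ∷_)) g w)) (sym (distribˡ k _ _))

  ⋆-assoc : ∀ f g h → (f ⋆ g) ⋆ h ≐ f ⋆ (g ⋆ h)
  ⋆-assoc f g h []      = *-assoc (f []) (g []) (h [])
  ⋆-assoc f g h (x ∷ w) = begin
    f [] * g [] * h (x ∷ w) + ((f [] ⊙ (g ∘ (x ∷_)) ⊕ f ∘ (x ∷_) ⋆ g) ⋆ h) w
      ≈⟨ +-congˡ (⋆-distribʳ h _ _ w) ⟩
    f [] * g [] * h (x ∷ w) + ((f [] ⊙ (g ∘ (x ∷_)) ⋆ h) w + (f ∘ (x ∷_) ⋆ g ⋆ h) w)
      ≈⟨ +-congˡ (+-cong (⊙-⋆-assoc (f []) (g ∘ (x ∷_)) h w)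
                         (⋆-assoc (f ∘ (x ∷_)) g h w)) ⟩
    f [] * g [] * h (x ∷ w) + (f [] * (g ∘ (x ∷_) ⋆ h) w + (f ∘ (x ∷_) ⋆ (g ⋆ h)) w)
      ≈⟨ +-assoc _ _ _ ⟨
    f [] * g [] * h (x ∷ w) + f [] * (g ∘ (x ∷_) ⋆ h) w + (f ∘ (x ∷_) ⋆ (g ⋆ h)) w
      ≈⟨ +-congʳ (trans (+-congʳ (*-assoc _ _ _)) (sym (distribˡ (f []) _ _))) ⟩
    f [] * (g [] * h (x ∷ w) + (g ∘ (x ∷_) ⋆ h) w) + (f ∘ (x ∷_) ⋆ (g ⋆ h)) w ∎

  monomial[]-⋆ : ∀ a g → monomial a [] ⋆ g ≐ a ⊙ g
  monomial[]-⋆ a g []      = *-congʳ (monomial-≡ a [] [] ≡.refl)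
  monomial[]-⋆ a g (x ∷ w) =
    trans (+-cong (*-congʳ (monomial-≡ a [] [] ≡.refl))
                  (⋆-zeroˡ g (λ p → monomial-≢ a [] (x ∷ p) λ ()) w))
      (+-identityʳ _)

  ⋆-identityʳ : ∀ f → f ⋆ 1ₛ ≐ f
  ⋆-identityʳ f []      = trans (*-congˡ (monomial-≡ 1# [] [] ≡.refl)) (*-identityʳ _)
  ⋆-identityʳ f (x ∷ w) =
    trans (+-cong (trans (*-congˡ (monomial-≢ 1# [] (x ∷ w) λ ())) (zeroʳ _))
                  (⋆-identityʳ (f ∘ (x ∷_)) w))
      (+-identityˡ _)

  monomial-⋆ : ∀ a b u v → monomial a u ⋆ monomial b v ≐ monomial (a * b) (u ++ v)
  monomial-⋆ a b []      v w       = trans (monomial[]-⋆ a (monomial b v) w) (*-monomial a b v w)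
  monomial-⋆ a b (y ∷ u) v []      =
    trans (*-congʳ (monomial-≢ a (y ∷ u) [] λ ()))
      (trans (zeroˡ _) (sym (monomial-≢ (a * b) (y ∷ u ++ v) [] λ ())))
  monomial-⋆ a b (y ∷ u) v (x ∷ w) =
    trans (+-congʳ (trans (*-congʳ (monomial-≢ a (y ∷ u) [] λ ())) (zeroˡ _)))
      (trans (+-identityˡ _) (by-cases (x ℕ.≟ y)))
    where
    by-cases : Dec (x ≡ y) →
               (monomial a (y ∷ u) ∘ (x ∷_) ⋆ monomial b v) w ≈
               monomial (a * b) (y ∷ u ++ v) (x ∷ w)
    by-cases (yes ≡.refl) = begin
      (monomial a (x ∷ u) ∘ (x ∷_) ⋆ monomial b v) w
        ≈⟨ ⋆-cong (monomial-∷ a x u) (λ _ → refl) w ⟩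
      (monomial a u ⋆ monomial b v) w
        ≈⟨ monomial-⋆ a b u v w ⟩
      monomial (a * b) (u ++ v) w
        ≈⟨ monomial-∷ (a * b) x (u ++ v) w ⟨
      monomial (a * b) (x ∷ u ++ v) (x ∷ w) ∎
    by-cases (no x≢y) =
      trans (⋆-zeroˡ (monomial b v) (λ p → monomial-≢ a (y ∷ u) (x ∷ p) y∷≢x∷) w)
        (sym (monomial-≢ (a * b) (y ∷ u ++ v) (x ∷ w) y∷≢x∷))
      where
      y∷≢x∷ : ∀ {p q} → y ∷ p ≢ x ∷ q
      y∷≢x∷ = x≢y ∘ ≡.sym ∘ ∷-injectiveˡ

  series-isRing : IsRing _≐_ _⊕_ _⋆_ ⊖_ 0ₛ 1ₛ
  series-isRing = record
    { +-isAbelianGroup = Pointwise.isAbelianGroup Word +-isAbelianGroup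
    ; *-cong           = ⋆-cong
    ; *-assoc          = ⋆-assoc
    ; *-identity       = (λ f w → trans (monomial[]-⋆ 1# f w) (*-identityˡ _)) , ⋆-identityʳ
    ; distrib          = ⋆-distribˡ , ⋆-distribʳ
    }

  series-ring : Ring c ℓ
  series-ring = record { isRing = series-isRing }

  coeff-++ : ∀ s t → coeff (s ++ t) ≐ coeff s ⊕ coeff t
  coeff-++ []            t w = sym (+-identityˡ _)
  coeff-++ ((a , u) ∷ s) t w = begin
    coeff ((a , u) ∷ s ++ t) w                ≈⟨ coeff-∷ a u (s ++ t) w ⟩
    monomial a u w + coeff (s ++ t) w         ≈⟨ +-congˡ (coeff-++ s t w) ⟩
    monomial a u w + (coeff s w + coeff t w)  ≈⟨ +-assoc _ _ _ ⟨
    monomial a u w + coeff s w + coeff t w    ≈⟨ +-congʳ (coeff-∷ a u s w) ⟨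
    coeff ((a , u) ∷ s) w + coeff t w         ∎

  coeff-neg : ∀ t → coeff (-T t) ≐ ⊖ coeff t
  coeff-neg []            w = sym -0#≈0#
  coeff-neg ((a , u) ∷ t) w = begin
    coeff ((- a , u) ∷ -T t) w             ≈⟨ coeff-∷ (- a) u (-T t) w ⟩
    monomial (- a) u w + coeff (-T t) w    ≈⟨ +-cong (-‿monomial a u w) (coeff-neg t w) ⟩
    - monomial a u w + - coeff t w         ≈⟨ -‿+-comm _ _ ⟩
    - (monomial a u w + coeff t w)         ≈⟨ -‿cong (coeff-∷ a u t w) ⟨
    - coeff ((a , u) ∷ t) w                ∎

  coeff-· : ∀ k t → coeff (k ·T t) ≐ k ⊙ coeff t
  coeff-· k []            w = sym (zeroʳ k)
  coeff-· k ((a , u) ∷ t) w = begin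
    coeff ((k * a , u) ∷ k ·T t) w                ≈⟨ coeff-∷ (k * a) u (k ·T t) w ⟩
    monomial (k * a) u w + coeff (k ·T t) w       ≈⟨ +-cong (sym (*-monomial k a u w)) (coeff-· k t w) ⟩
    k * monomial a u w + k * coeff t w            ≈⟨ distribˡ k _ _ ⟨
    k * (monomial a u w + coeff t w)              ≈⟨ *-congˡ (coeff-∷ a u t w) ⟨
    k * coeff ((a , u) ∷ t) w                     ∎

  coeff-monomial-*T : ∀ a u t → coeff (((a , u) ∷ []) *T t) ≐ monomial a u ⋆ coeff t
  coeff-monomial-*T a u []            w = sym (⋆-zeroʳ (monomial a u) (λ _ → refl) w)
  coeff-monomial-*T a u ((b , v) ∷ t) w = begin
    coeff ((a * b , u ++ v) ∷ ((a , u) ∷ []) *T t) w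
      ≈⟨ coeff-∷ (a * b) (u ++ v) _ w ⟩
    monomial (a * b) (u ++ v) w + coeff (((a , u) ∷ []) *T t) w
      ≈⟨ +-cong (sym (monomial-⋆ a b u v w)) (coeff-monomial-*T a u t w) ⟩
    (monomial a u ⋆ monomial b v) w + (monomial a u ⋆ coeff t) w
      ≈⟨ ⋆-distribˡ (monomial a u) _ _ w ⟨
    (monomial a u ⋆ (monomial b v ⊕ coeff t)) w
      ≈⟨ ⋆-cong (λ _ → refl) (coeff-∷ b v t) w ⟨
    (monomial a u ⋆ coeff ((b , v) ∷ t)) w ∎

  *T-∷ : ∀ a u s t → ((a , u) ∷ s) *T t ≡ ((a , u) ∷ []) *T t ++ s *T t
  *T-∷ a u s t = ≡.cong (_++ s *T t) (≡.sym (++-identityʳ _))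

  coeff-*T : ∀ s t → coeff (s *T t) ≐ coeff s ⋆ coeff t
  coeff-*T []            t w = sym (⋆-zeroˡ (coeff t) (λ _ → refl) w)
  coeff-*T ((a , u) ∷ s) t w = begin
    coeff (((a , u) ∷ s) *T t) w
      ≡⟨ ≡.cong (λ r → coeff r w) (*T-∷ a u s t) ⟩
    coeff (((a , u) ∷ []) *T t ++ s *T t) w
      ≈⟨ coeff-++ (((a , u) ∷ []) *T t) (s *T t) w ⟩
    coeff (((a , u) ∷ []) *T t) w + coeff (s *T t) w
      ≈⟨ +-cong (coeff-monomial-*T a u t w) (coeff-*T s t w) ⟩
    (monomial a u ⋆ coeff t) w + (coeff s ⋆ coeff t) w
      ≈⟨ ⋆-distribʳ (coeff t) _ _ w ⟨
    ((monomial a u ⊕ coeff s) ⋆ coeff t) w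
      ≈⟨ ⋆-cong (coeff-∷ a u s) (λ _ → refl) w ⟨
    (coeff ((a , u) ∷ s) ⋆ coeff t) w ∎

  -- A record around _≈T_: the operations of T are list functions, which block unification,
  -- so Agda could not infer the arguments of the bare relation.
  infix 4 _≃_
  record _≃_ (s t : T) : Set ℓ where
    constructor ≃⁺
    field ≃⁻ : s ≈T t
  open _≃_ public

  T-rawRing : RawRing c ℓ
  T-rawRing = record { _≈_ = _≃_ ; _+_ = _+T_ ; _*_ = _*T_ ; -_ = -T_ ; 0# = 0T ; 1# = 1T }

  coeff-isRingMonomorphism : IsRingMonomorphism T-rawRing (Ring.rawRing series-ring) coeff
  coeff-isRingMonomorphism = record
    { isRingHomomorphism = record
      { isSemiringHomomorphism = record
        { isNearSemiringHomomorphism = record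
          { +-isMonoidHomomorphism = record
            { isMagmaHomomorphism = record
              { isRelHomomorphism = record { cong = ≃⁻ }
              ; homo              = coeff-++
              }
            ; ε-homo = λ _ → refl
            }
          ; *-homo = coeff-*T
          }
        ; 1#-homo = λ _ → refl
        }
      ; -‿homo = coeff-neg
      }
    ; injective = ≃⁺
    }

  T-ring : Ring c ℓ
  T-ring = record { isRing = RingMonomorphism.isRing coeff-isRingMonomorphism series-isRing }

module FieldNaturals {c ℓ : Level} (F : Field c ℓ) (char0 : CharZero F) where
  open Field F
  open Construction F char0 using (invℕ)
  open import Algebra.Properties.CommutativeSemigroup *-commutativeSemigroup using (interchange)
  open import Relation.Binary.Reasoning.Setoid setoid

  natK-+ : ∀ m n → natK F (m ℕ.+ n) ≈ natK F m + natK F n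
  natK-+ zero    n = sym (+-identityˡ _)
  natK-+ (suc m) n = trans (+-congˡ (natK-+ m n)) (sym (+-assoc _ _ _))

  natK-* : ∀ m n → natK F (m ℕ.* n) ≈ natK F m * natK F n
  natK-* zero    n = sym (zeroˡ _)
  natK-* (suc m) n = begin
    natK F (n ℕ.+ m ℕ.* n)               ≈⟨ natK-+ n (m ℕ.* n) ⟩
    natK F n + natK F (m ℕ.* n)          ≈⟨ +-cong (sym (*-identityˡ _)) (natK-* m n) ⟩
    1# * natK F n + natK F m * natK F n  ≈⟨ distribʳ _ _ _ ⟨
    (1# + natK F m) * natK F n           ∎

  invℕ-inverse : ∀ n → natK F (suc n) * invℕ (suc n) ≈ 1#
  invℕ-inverse n = proj₂ (inverse (natK F (suc n)) (char0 n))

  invℕ-unique : ∀ n {x} → natK F (suc n) * x ≈ 1# → x ≈ invℕ (suc n)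
  invℕ-unique n {x} nx≈1 = begin
    x                                    ≈⟨ *-identityʳ x ⟨
    x * 1#                               ≈⟨ *-congˡ (invℕ-inverse n) ⟨
    x * (natK F (suc n) * invℕ (suc n))  ≈⟨ *-assoc _ _ _ ⟨
    x * natK F (suc n) * invℕ (suc n)    ≈⟨ *-congʳ (trans (*-comm _ _) nx≈1) ⟩
    1# * invℕ (suc n)                    ≈⟨ *-identityˡ _ ⟩
    invℕ (suc n)                         ∎

  invℕ-1 : invℕ 1 ≈ 1#
  invℕ-1 = sym (invℕ-unique 0 (trans (*-identityʳ _) (+-identityʳ 1#)))

  -- No positivity hypotheses: with the junk value invℕ 0 = 0 both sides vanish when m or n is 0.
  invℕ-* : ∀ m n → invℕ (m ℕ.* n) ≈ invℕ m * invℕ n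
  invℕ-* zero    n       = sym (zeroˡ _)
  invℕ-* (suc m) zero    = trans (reflexive (≡.cong invℕ (ℕ.*-zeroʳ m))) (sym (zeroʳ _))
  invℕ-* (suc m) (suc n) = sym (invℕ-unique (n ℕ.+ m ℕ.* suc n) (begin
    natK F (suc m ℕ.* suc n) * (invℕ (suc m) * invℕ (suc n))
      ≈⟨ *-congʳ (natK-* (suc m) (suc n)) ⟩
    natK F (suc m) * natK F (suc n) * (invℕ (suc m) * invℕ (suc n))
      ≈⟨ interchange _ _ _ _ ⟩
    natK F (suc m) * invℕ (suc m) * (natK F (suc n) * invℕ (suc n))
      ≈⟨ *-cong (invℕ-inverse m) (invℕ-inverse n) ⟩
    1# * 1#
      ≈⟨ *-identityˡ 1# ⟩
    1# ∎))

module SequenceAlgebra {c ℓ : Level} (F : Field c ℓ) (char0 : CharZero F) where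
  open Construction F char0
  open FreeAlgebra F char0
    using (_≃_; ≃⁺; ≃⁻; T-ring; coeff-++; coeff-·; coeff-*T; ⋆-cong; ⊙-⋆-assoc; ⋆-⊙-comm)
  open FieldNaturals F char0 using (invℕ-inverse)
  private
    module K = Field F
    module T = Ring T-ring

  -- Wrapped for the same reason as _≃_.
  infix 4 _≋_
  record _≋_ (x y : 𝒜) : Set ℓ where
    constructor ≋⁺
    field ≋⁻ : ∀ m → x m ≃ y m
  open _≋_ public

  neg𝒜 : 𝒜 → 𝒜
  neg𝒜 x m = -T x m

  𝒜-rawRing : RawRing c ℓ
  𝒜-rawRing = record
    { _≈_ = _≋_ ; _+_ = _+𝒜_ ; _*_ = _*𝒜_ ; -_ = neg𝒜 ; 0# = 0𝒜 ; 1# = 1𝒜 }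

  id-isRingMonomorphism : IsRingMonomorphism 𝒜-rawRing (Ring.rawRing (Pointwise.ring ℕ T-ring)) id
  id-isRingMonomorphism = record
    { isRingHomomorphism = record
      { isSemiringHomomorphism = record
        { isNearSemiringHomomorphism = record
          { +-isMonoidHomomorphism = record
            { isMagmaHomomorphism = record
              { isRelHomomorphism = record { cong = ≋⁻ }
              ; homo              = λ _ _ _ → T.refl
              }
            ; ε-homo = λ _ → T.refl
            }
          ; *-homo = λ _ _ _ → T.refl
          }
        ; 1#-homo = λ _ → T.refl
        }
      ; -‿homo = λ _ _ → T.refl
      }
    ; injective = ≋⁺
    }

  𝒜-ring : Ring c ℓ
  𝒜-ring = record
    { isRing = RingMonomorphism.isRing id-isRingMonomorphism (Pointwise.isRing ℕ T.isRing) }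

  open Ring 𝒜-ring
  open RingSums 𝒜-ring using (homo-×)
  open import Algebra.Properties.Semiring.Mult semiring using (_×_)
  open import Algebra.Properties.CommutativeSemigroup T.+-commutativeSemigroup using (interchange)
  open import Relation.Binary.Reasoning.Setoid setoid

  ρ-cong : ∀ {x y} → x ≈ y → ρ x ≈ ρ y
  ρ-cong {x} {y} x≈y = ≋⁺ go
    where
    go : ∀ m → ρ x m ≃ ρ y m
    go zero    = T.refl
    go (suc m) = T.+-cong (go m) (≋⁻ x≈y m)

  ρ-+ : ∀ x y → ρ (x + y) ≈ ρ x + ρ y
  ρ-+ x y = ≋⁺ go
    where
    go : ∀ m → ρ (x + y) m ≃ ρ x m +T ρ y m
    go zero    = T.refl
    go (suc m) = T.trans (T.+-congʳ {x m +T y m} (go m)) (interchange (ρ x m) (ρ y m) (x m) (y m))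

  ρ-0 : ρ 0𝒜 ≈ 0𝒜
  ρ-0 = ≋⁺ go
    where
    go : ∀ m → ρ 0𝒜 m ≃ 0T
    go zero    = T.refl
    go (suc m) = T.trans (T.+-identityʳ (ρ 0𝒜 m)) (go m)

  ρ-rotaBaxter : ∀ x y → ρ x * ρ y ≈ ρ (ρ x * y + x * ρ y + x * y)
  ρ-rotaBaxter x y = ≋⁺ go
    where
    expand : ∀ a b d e → (a T.+ b) T.* (d T.+ e) ≃ a T.* d T.+ (a T.* e T.+ b T.* d T.+ b T.* e)
    expand a b d e =
      T.trans (T.distribʳ (d T.+ e) a b) (T.trans (T.+-cong (T.distribˡ a d e) (T.distribˡ b d e))
        (T.trans (T.+-assoc (a T.* d) (a T.* e) (b T.* d T.+ b T.* e))
          (T.+-congˡ {a T.* d} (T.sym (T.+-assoc (a T.* e) (b T.* d) (b T.* e))))))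
    go : ∀ m → ρ x m *T ρ y m ≃ ρ (ρ x * y + x * ρ y + x * y) m
    go zero    = T.refl
    go (suc m) =
      T.trans (expand (ρ x m) (x m) (ρ y m) (y m)) (T.+-congʳ {(ρ x * y + x * ρ y + x * y) m} (go m))

  ρ-isWeightOneRotaBaxter : IsWeightOneRotaBaxter 𝒜-ring ρ
  ρ-isWeightOneRotaBaxter = record
    { +-isMonoidHomomorphism = record
      { isMagmaHomomorphism = record { isRelHomomorphism = record { cong = ρ-cong } ; homo = ρ-+ }
      ; ε-homo              = ρ-0
      }
    ; rotaBaxter = ρ-rotaBaxter
    }

  private
    coeffwise : ∀ {x y} → (∀ m w → coeff (x m) w K.≈ coeff (y m) w) → x ≈ y
    coeffwise x≈y = ≋⁺ λ m → ≃⁺ (x≈y m)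

  infixr 8 _·_
  _·_ : K.Carrier → 𝒜 → 𝒜
  _·_ = _·𝒜_

  ·-cong : ∀ {k l x y} → k K.≈ l → x ≈ y → k · x ≈ l · y
  ·-cong {k} {l} {x} {y} k≈l x≈y = coeffwise λ m w →
    K.trans (coeff-· k (x m) w)
      (K.trans (K.*-cong k≈l (≃⁻ (≋⁻ x≈y m) w)) (K.sym (coeff-· l (y m) w)))

  ·-distribˡ : ∀ k x y → k · (x + y) ≈ k · x + k · y
  ·-distribˡ k x y = coeffwise λ m w →
    K.trans (coeff-· k (x m +T y m) w) (K.trans (K.*-congˡ (coeff-++ (x m) (y m) w))
      (K.trans (K.distribˡ k _ _)
        (K.trans (K.+-cong (K.sym (coeff-· k (x m) w)) (K.sym (coeff-· k (y m) w)))
          (K.sym (coeff-++ (k ·T x m) (k ·T y m) w)))))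

  ·-distribʳ : ∀ k l x → (k K.+ l) · x ≈ k · x + l · x
  ·-distribʳ k l x = coeffwise λ m w →
    K.trans (coeff-· (k K.+ l) (x m) w) (K.trans (K.distribʳ _ k l)
      (K.trans (K.+-cong (K.sym (coeff-· k (x m) w)) (K.sym (coeff-· l (x m) w)))
        (K.sym (coeff-++ (k ·T x m) (l ·T x m) w))))

  ·-assoc : ∀ k l x → (k K.* l) · x ≈ k · l · x
  ·-assoc k l x = coeffwise λ m w →
    K.trans (coeff-· (k K.* l) (x m) w) (K.trans (K.*-assoc k l _)
      (K.trans (K.*-congˡ (K.sym (coeff-· l (x m) w))) (K.sym (coeff-· k (l ·T x m) w))))

  ·-identity : ∀ x → K.1# · x ≈ x
  ·-identity x = coeffwise λ m w → K.trans (coeff-· K.1# (x m) w) (K.*-identityˡ _)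

  ·-zero : ∀ x → K.0# · x ≈ 0𝒜
  ·-zero x = coeffwise λ m w → K.trans (coeff-· K.0# (x m) w) (K.zeroˡ _)

  ·-*-assoc : ∀ k x y → (k · x) * y ≈ k · (x * y)
  ·-*-assoc k x y = coeffwise λ m w →
    K.trans (coeff-*T (k ·T x m) (y m) w) (K.trans (⋆-cong (coeff-· k (x m)) (λ _ → K.refl) w)
      (K.trans (⊙-⋆-assoc k _ _ w)
        (K.trans (K.*-congˡ (K.sym (coeff-*T (x m) (y m) w))) (K.sym (coeff-· k (x m *T y m) w)))))

  *-·-comm : ∀ k x y → x * (k · y) ≈ k · (x * y)
  *-·-comm k x y = coeffwise λ m w →
    K.trans (coeff-*T (x m) (k ·T y m) w) (K.trans (⋆-cong (λ _ → K.refl) (coeff-· k (y m)) w)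
      (K.trans (⋆-⊙-comm k _ _ w)
        (K.trans (K.*-congˡ (K.sym (coeff-*T (x m) (y m) w))) (K.sym (coeff-· k (x m *T y m) w)))))

  ·-isMonoidHomomorphism : ∀ k → IsMonoidHomomorphism +-rawMonoid +-rawMonoid (k ·_)
  ·-isMonoidHomomorphism k = record
    { isMagmaHomomorphism = record
      { isRelHomomorphism = record { cong = ·-cong K.refl }
      ; homo              = ·-distribˡ k
      }
    ; ε-homo = ≋⁺ λ _ → T.refl
    }

  ×-· : ∀ n k x → n × (k · x) ≈ (natK F n K.* k) · x
  ×-· zero    k x = sym (trans (·-cong (K.zeroˡ k) refl) (·-zero x))
  ×-· (suc n) k x = begin
    k · x + n × (k · x)                 ≈⟨ +-congˡ (×-· n k x) ⟩
    k · x + (natK F n K.* k) · x        ≈⟨ ·-distribʳ _ _ x ⟨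
    (k K.+ natK F n K.* k) · x          ≈⟨ ·-cong (K.+-congʳ (K.*-identityˡ k)) refl ⟨
    (K.1# K.* k K.+ natK F n K.* k) · x  ≈⟨ ·-cong (K.distribʳ k _ _) refl ⟨
    (natK F (suc n) K.* k) · x          ∎

  ×-invℕ : ∀ n → 0 < n → ∀ x → n × (invℕ n · x) ≈ x
  ×-invℕ (suc n) _ x = trans (×-· (suc n) _ x) (trans (·-cong (invℕ-inverse n) refl) (·-identity x))

  ×-cancel : ∀ n {x y} → suc n × x ≈ suc n × y → x ≈ y
  ×-cancel n {x} {y} n×x≈n×y = begin
    x                ≈⟨ ×-invℕ (suc n) (s≤s z≤n) x ⟨
    suc n × (k · x)  ≈⟨ homo-× (·-isMonoidHomomorphism k) (suc n) x ⟨
    k · (suc n × x)  ≈⟨ ·-cong K.refl n×x≈n×y ⟩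
    k · (suc n × y)  ≈⟨ homo-× (·-isMonoidHomomorphism k) (suc n) y ⟩
    suc n × (k · y)  ≈⟨ ×-invℕ (suc n) (s≤s z≤n) y ⟩
    y                ∎
    where
    k : K.Carrier
    k = invℕ (suc n)

module CompositionSums {f ℓ : Level} (F : Field f ℓ) (char0 : CharZero F) where
  open Construction F char0
  open SequenceAlgebra F char0
  open Ring 𝒜-ring
  open RingSums 𝒜-ring
  open FieldNaturals F char0 using (invℕ-1; invℕ-*)
  open RotaBaxterRecursion 𝒜-ring ρ-isWeightOneRotaBaxter X
    using (_•_; c; C; ρPow; ρPow-solvesRecursion)
  open import Algebra.Properties.Semiring.Mult semiring using (_×_; ×-congˡ; ×-congʳ; ×-comm-*)
  open import Data.Nat.Induction using (<-rec)
  open import Relation.Binary.Reasoning.Setoid setoid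
  private module K = Field F

  c⁽⁾X≡c : ∀ n → c⁽ n ⁾ X ≡ c n
  c⁽⁾X≡c zero          = ≡.refl
  c⁽⁾X≡c (suc zero)    = ≡.refl
  c⁽⁾X≡c (suc (suc n)) = ≡.cong (_• X) (c⁽⁾X≡c (suc n))

  ρXpow≈ρPow : ∀ n → ρXpow (suc n) ≈ ρPow (suc n)
  ρXpow≈ρPow zero    = ρ-cong (sym (*-identityˡ X))
  ρXpow≈ρPow (suc n) = ρ-cong (*-congʳ (ρXpow≈ρPow n))

  compositionTerm : ℕ → List ℕ → 𝒜
  compositionTerm s is = invℕ (denomFrom s is) · prodC is

  compositionSum : ℕ → ℕ → 𝒜
  compositionSum s n = ∑ₗ (compositions n) (compositionTerm s)

  compositionsF-fuel : ∀ f g n → n ≤ f → n ≤ g → compositionsF f n ≡ compositionsF g n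
  compositionsF-fuel _       _       zero    _         _         = ≡.refl
  compositionsF-fuel (suc f) (suc g) (suc n) (s≤s n≤f) (s≤s n≤g) =
    concatMap-cong (λ i → ≡.cong (map (suc i ∷_)) (compositionsF-fuel f g (n ∸ i) (n∸i≤ i n≤f) (n∸i≤ i n≤g)))
                   (upTo (suc n))
    where
    n∸i≤ : ∀ i {k} → n ≤ k → n ∸ i ≤ k
    n∸i≤ i = ℕ.≤-trans (ℕ.m∸n≤m n i)

  compositionSum-zero : ∀ s → compositionSum s 0 ≈ 1#
  compositionSum-zero s = trans (+-identityʳ _) (trans (·-cong invℕ-1 refl) (·-identity 1#))

  compositionTerm-∷ : ∀ s i is →
    compositionTerm s (i ∷ is) ≈ invℕ (s ℕ.+ i) · (C i * compositionTerm (s ℕ.+ i) is)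
  compositionTerm-∷ s i is = begin
    invℕ ((s ℕ.+ i) ℕ.* d) · (C⁽ i ⁾ X * prodC is)
      ≈⟨ ·-cong (invℕ-* (s ℕ.+ i) d) (reflexive (≡.cong (λ x → ρ x * prodC is) (c⁽⁾X≡c i))) ⟩
    (invℕ (s ℕ.+ i) K.* invℕ d) · (C i * prodC is)
      ≈⟨ ·-assoc _ _ _ ⟩
    invℕ (s ℕ.+ i) · invℕ d · (C i * prodC is)
      ≈⟨ ·-cong K.refl (*-·-comm (invℕ d) (C i) (prodC is)) ⟨
    invℕ (s ℕ.+ i) · (C i * (invℕ d · prodC is)) ∎
    where
    d : ℕ
    d = denomFrom (s ℕ.+ i) is

  compositionSum-suc : ∀ s m → compositionSum s (suc m) ≈
    ∑[ i < suc m ] (invℕ (s ℕ.+ suc i) · (C (suc i) * compositionSum (s ℕ.+ suc i) (m ∸ i)))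
  compositionSum-suc s m = begin
    compositionSum s (suc m)
      ≈⟨ ∑ₗ-concatMap (λ i → map (suc i ∷_) (compositionsF m (m ∸ i))) (upTo (suc m)) _ ⟩
    ∑ₗ (upTo (suc m)) (λ i → ∑ₗ (map (suc i ∷_) (compositionsF m (m ∸ i))) (compositionTerm s))
      ≈⟨ ∑ₗ-applyUpTo id (suc m) _ ⟩
    ∑[ i < suc m ] ∑ₗ (map (suc i ∷_) (compositionsF m (m ∸ i))) (compositionTerm s)
      ≈⟨ ∑-cong (suc m) first-part ⟩
    ∑[ i < suc m ] (invℕ (s ℕ.+ suc i) · (C (suc i) * compositionSum (s ℕ.+ suc i) (m ∸ i))) ∎
    where
    first-part : ∀ i → ∑ₗ (map (suc i ∷_) (compositionsF m (m ∸ i))) (compositionTerm s) ≈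
                       invℕ (s ℕ.+ suc i) · (C (suc i) * compositionSum (s ℕ.+ suc i) (m ∸ i))
    first-part i = begin
      ∑ₗ (map (suc i ∷_) L) (compositionTerm s)
        ≈⟨ ∑ₗ-map (suc i ∷_) L (compositionTerm s) ⟩
      ∑ₗ L (compositionTerm s ∘ (suc i ∷_))
        ≈⟨ ∑ₗ-cong L (compositionTerm-∷ s (suc i)) ⟩
      ∑ₗ L (λ is → k · (C (suc i) * compositionTerm s′ is))
        ≈⟨ ∑ₗ-homo (·-isMonoidHomomorphism k) L _ ⟨
      k · ∑ₗ L (λ is → C (suc i) * compositionTerm s′ is)
        ≈⟨ ·-cong K.refl (∑ₗ-distribˡ (C (suc i)) L _) ⟨
      k · (C (suc i) * ∑ₗ L (compositionTerm s′))
        ≡⟨ ≡.cong (λ L → k · (C (suc i) * ∑ₗ L (compositionTerm s′)))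
                  (compositionsF-fuel m (m ∸ i) (m ∸ i) (ℕ.m∸n≤m m i) ℕ.≤-refl) ⟩
      k · (C (suc i) * compositionSum s′ (m ∸ i)) ∎
      where
      L : List (List ℕ)
      L = compositionsF m (m ∸ i)
      s′ : ℕ
      s′ = s ℕ.+ suc i
      k : K.Carrier
      k = invℕ s′

  ShiftedRecursion : ℕ → ℕ → Set ℓ
  ShiftedRecursion s n = (s ℕ.+ n) × compositionSum s n ≈ ∑[ k < n ] (compositionSum s k * C (n ∸ k))

  module _ (s m : ℕ) where
    private
      N : ℕ
      N = s ℕ.+ suc m

      S : ℕ → ℕ → 𝒜
      S i = compositionSum (s ℕ.+ suc i)

      t : ℕ → 𝒜
      t i = invℕ (s ℕ.+ suc i) · (C (suc i) * S i (m ∸ i))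

      G : ℕ → ℕ → 𝒜
      G i k = invℕ (s ℕ.+ suc i) · (C (suc i) * S i (k ∸ i)) * C (m ∸ k)

      last-term : N × t m ≈ C (suc m)
      last-term = begin
        N × t m
          ≈⟨ ×-congʳ N (·-cong K.refl (*-congˡ {C (suc m)} (reflexive (≡.cong (S m) (ℕ.n∸n≡0 m))))) ⟩
        N × (invℕ N · (C (suc m) * S m 0))
          ≈⟨ ×-congʳ N (·-cong K.refl (trans (*-congˡ {C (suc m)} (compositionSum-zero N))
                                             (*-identityʳ (C (suc m))))) ⟩
        N × (invℕ N · C (suc m))
          ≈⟨ ×-invℕ N (ℕ.<-≤-trans ℕ.0<1+n (ℕ.m≤n+m (suc m) s)) _ ⟩
        C (suc m) ∎

      inner-term : ∀ i → i < m → ShiftedRecursion (s ℕ.+ suc i) (m ∸ i) →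
                   N × t i ≈ ∑[ j < m ∸ i ] G i (i ℕ.+ j)
      inner-term i i<m ih = begin
        N × (k · (C (suc i) * S i (m ∸ i)))
          ≈⟨ homo-× (·-isMonoidHomomorphism k) N (C (suc i) * S i (m ∸ i)) ⟨
        k · (N × (C (suc i) * S i (m ∸ i)))
          ≈⟨ ·-cong K.refl (×-comm-* N (C (suc i)) (S i (m ∸ i))) ⟨
        k · (C (suc i) * (N × S i (m ∸ i)))
          ≈⟨ ·-cong K.refl (*-congˡ {C (suc i)} (trans (×-congˡ {S i (m ∸ i)} N≡) ih)) ⟩
        k · (C (suc i) * ∑[ j < m ∸ i ] (S i j * C (m ∸ i ∸ j)))
          ≈⟨ ·-cong K.refl (∑-distribˡ (C (suc i)) (m ∸ i) λ j → S i j * C (m ∸ i ∸ j)) ⟩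
        k · ∑[ j < m ∸ i ] (C (suc i) * (S i j * C (m ∸ i ∸ j)))
          ≈⟨ ∑-homo (·-isMonoidHomomorphism k) (m ∸ i) _ ⟩
        ∑[ j < m ∸ i ] (k · (C (suc i) * (S i j * C (m ∸ i ∸ j))))
          ≈⟨ ∑-cong (m ∸ i) reassociate ⟩
        ∑[ j < m ∸ i ] G i (i ℕ.+ j) ∎
        where
        k : K.Carrier
        k = invℕ (s ℕ.+ suc i)

        N≡ : N ≡ s ℕ.+ suc i ℕ.+ (m ∸ i)
        N≡ = ≡.trans (≡.cong (λ n → s ℕ.+ suc n) (≡.sym (ℕ.m+[n∸m]≡n (ℕ.<⇒≤ i<m))))
                     (≡.sym (ℕ.+-assoc s (suc i) (m ∸ i)))

        reassociate : ∀ j → k · (C (suc i) * (S i j * C (m ∸ i ∸ j))) ≈ G i (i ℕ.+ j)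
        reassociate j = begin
          k · (C (suc i) * (S i j * C (m ∸ i ∸ j)))
            ≈⟨ ·-cong K.refl (*-assoc (C (suc i)) (S i j) (C (m ∸ i ∸ j))) ⟨
          k · (C (suc i) * S i j * C (m ∸ i ∸ j))
            ≈⟨ ·-*-assoc k (C (suc i) * S i j) (C (m ∸ i ∸ j)) ⟨
          k · (C (suc i) * S i j) * C (m ∸ i ∸ j)
            ≡⟨ ≡.cong₂ (λ a b → k · (C (suc i) * S i a) * C b)
                       (≡.sym (ℕ.m+n∸m≡n i j)) (ℕ.∸-+-assoc m i j) ⟩
          G i (i ℕ.+ j) ∎

      expand-summand : ∀ k → compositionSum s (suc k) * C (m ∸ k) ≈ ∑[ i < suc k ] G i k
      expand-summand k = trans (*-congʳ (compositionSum-suc s k))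
        (∑-distribʳ (C (m ∸ k)) (suc k) λ i → invℕ (s ℕ.+ suc i) · (C (suc i) * S i (k ∸ i)))

    shiftedRecursion-suc : (∀ i → i < m → ShiftedRecursion (s ℕ.+ suc i) (m ∸ i)) →
                           ShiftedRecursion s (suc m)
    shiftedRecursion-suc ih = begin
      N × compositionSum s (suc m)
        ≈⟨ ×-congʳ N (compositionSum-suc s m) ⟩
      N × ∑< (suc m) t
        ≈⟨ ∑-homo (×-isMonoidHomomorphism N) (suc m) t ⟩
      ∑[ i < suc m ] (N × t i)
        ≈⟨ ∑-init-last m (λ i → N × t i) ⟩
      ∑[ i < m ] (N × t i) + N × t m
        ≈⟨ +-cong (∑-cong< m λ i i<m → inner-term i i<m (ih i i<m)) last-term ⟩
      ∑[ i < m ] ∑[ j < m ∸ i ] G i (i ℕ.+ j) + C (suc m)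
        ≈⟨ +-congʳ (∑-triangle m G) ⟩
      ∑[ k < m ] ∑[ i < suc k ] G i k + C (suc m)
        ≈⟨ +-comm (∑[ k < m ] ∑[ i < suc k ] G i k) (C (suc m)) ⟩
      C (suc m) + ∑[ k < m ] ∑[ i < suc k ] G i k
        ≈⟨ +-cong first-summand (∑-cong m expand-summand) ⟨
      compositionSum s 0 * C (suc m) + ∑[ k < m ] (compositionSum s (suc k) * C (m ∸ k)) ∎
      where
      first-summand : compositionSum s 0 * C (suc m) ≈ C (suc m)
      first-summand = trans (*-congʳ (compositionSum-zero s)) (*-identityˡ (C (suc m)))

  shiftedRecursion : ∀ n s → 0 < n → ShiftedRecursion s n
  shiftedRecursion = <-rec _ λ { (suc m) rec s _ →
    shiftedRecursion-suc s m λ i i<m →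
      rec (s≤s (ℕ.m∸n≤m m i)) (s ℕ.+ suc i) (ℕ.m<n⇒0<n∸m i<m) }

  compositionSum-solvesRecursion : SolvesRecursion 𝒜-ring C (compositionSum 0)
  compositionSum-solvesRecursion zero    = refl
  compositionSum-solvesRecursion (suc m) = shiftedRecursion (suc m) 0 (s≤s z≤n)

  ρXpow≈rhs : ∀ n → ρXpow (suc n) ≈ rhs (suc n)
  ρXpow≈rhs n = trans (ρXpow≈ρPow n)
    (solvesRecursion-unique 𝒜-ring ×-cancel {C} ρPow-solvesRecursion compositionSum-solvesRecursion
      (sym (compositionSum-zero 0)) (suc n))

mainTheorem9 : ∀ {c ℓ : Level} (F : Field c ℓ) (char0 : CharZero F) (n : ℕ) → 1 ≤ n →
    Construction._≈𝒜_ F char0 (Construction.ρXpow F char0 n) (Construction.rhs F char0 n)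
mainTheorem9 F char0 (suc n) _ m = ≃⁻ (≋⁻ (CompositionSums.ρXpow≈rhs F char0 n) m)
  where
  open FreeAlgebra F char0 using (≃⁻)
  open SequenceAlgebra F char0 using (≋⁻)
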